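{- For every $n\ge1$ there exists a generalized NFA $M$ over a binary alphabet with $n$ states, each of which is both initial and final, such that the minimal DFA accepting $L(M)$ has $2^n$ states.
   Context: A generalized NFA is $M=(Q,\Sigma,\delta,I,F)$ with transition function $\delta:Q\times\Sigma\to2^Q$, a set $I$ of initial states and a set $F$ of final states; it accepts $w$ iff $\delta(I,w)\cap F\ne\emptyset$. DFAs are complete (exactly one transition from every state on every letter); the minimal DFA of a language is the complete DFA with fewest states accepting it. -}

module Defs where

open import Data.Nat using (ℕ; _≤_)
open import Data.Bool using (Bool; true; _∧_)
open import Data.Fin using (Fin)
open import Data.Fin.Subset using (Subset; _∩_; Nonempty)
open import Data.List using (List; []; _∷_; allFin)
open import Data.Bool.ListAction using (any)
open import Data.Vec using (lookup; tabulate)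
open import Data.Product using (Σ; _×_)
open import Function.Bundles using (_⇔_)
open import Relation.Binary.PropositionalEquality using (_≡_)

Σ₂ : Set
Σ₂ = Fin 2

Word : Set
Word = List Σ₂

Language : Set₁
Language = Word → Set

record GNFA (n : ℕ) : Set where
  field
    δ : Fin n → Σ₂ → Subset n
    I : Subset n
    F : Subset n

open GNFA public

stepSet : ∀ {n} → GNFA n → Subset n → Σ₂ → Subset n
stepSet {n} M S a =
  tabulate λ p → any (λ q → lookup S q ∧ lookup (δ M q a) p) (allFin n)

runSet : ∀ {n} → GNFA n → Subset n → Word → Subset n
runSet M S []      = S
runSet M S (a ∷ w) = runSet M (stepSet M S a) w

NAccepts : ∀ {n} → GNFA n → Word → Set
NAccepts M w = Nonempty (runSet M (I M) w ∩ F M)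

L : ∀ {n} → GNFA n → Language
L M = NAccepts M

record DFA (k : ℕ) : Set where
  field
    trans : Fin k → Σ₂ → Fin k
    start : Fin k
    final : Fin k → Bool

run : ∀ {k} → DFA k → Fin k → Word → Fin k
run D q []      = q
run D q (a ∷ w) = run D (DFA.trans D q a) w

DAccepts : ∀ {k} → DFA k → Word → Set
DAccepts D w = DFA.final D (run D (DFA.start D) w) ≡ true

AcceptsLang : ∀ {k} → DFA k → Language → Set
AcceptsLang D L' = ∀ w → DAccepts D w ⇔ L' w

MinimalDFASize : Language → ℕ → Set
MinimalDFASize L' m =
  Σ (DFA m) (λ D → AcceptsLang D L') ×
  (∀ k (D : DFA k) → AcceptsLang D L' → m ≤ k)

-- States 0, …, n−1 sit on a cycle; letter 1 moves every state one step back along it and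
-- letter 0 kills state 0 while fixing the others. On sets of states, 1 rotates the
-- characteristic vector and 0 clears its head, so reading, for each position in turn, 1 if the
-- bit of T is set and 01 otherwise intersects the current set with T. Hence every subset is
-- reached from I = Q, and two different reached sets are told apart by the mask word of a
-- singleton {p} with p in just one of them: every DFA needs 2^n states, and the subset
-- construction uses exactly that many.
module Submission where

open import Defs
open import Data.Bool using (Bool; true; false; T; _∧_)
open import Data.Bool.Properties using (∧-identityʳ; ∧-zeroʳ)
open import Data.Bool.ListAction using (any)
open import Data.Empty using (⊥-elim)
open import Data.Fin using (Fin; zero; suc; fromℕ; inject₁)
open import Data.Fin.Properties using (_≟_; 2↔Bool; fromℕ≢inject₁; inject₁-injective; injective⇒≤)
open import Data.Fin.Subset using (Subset; ⊤; ⊥; ⁅_⁆; _∈_; _⊆_; _∩_; inside; outside)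
open import Data.Fin.Subset.Properties using (nonempty?; ∈⊤; x∈⁅x⁆; x∈⁅y⁆⇒x≡y; x∈p∩q⁺; x∈p∩q⁻; ∩-identityˡ; ⊆-antisym)
open import Data.List using (List; []; _∷_; _++_; [_]; allFin; length; zipWith)
open import Data.List.Membership.Propositional using (lose)
open import Data.List.Membership.Propositional.Properties using (∈-allFin)
open import Data.List.Properties using (++-assoc; ++-identityʳ)
open import Data.List.Relation.Unary.Any using (satisfied)
open import Data.List.Relation.Unary.Any.Properties using (any⁺; any⁻)
open import Data.Nat using (ℕ; zero; suc; pred; _≤_; _^_)
open import Data.Product using (Σ; ∃; _×_; _,_; proj₁)
open import Data.Vec as Vec using (Vec; lookup; toList; _∷ʳ_)
open import Data.Vec.Properties using (lookup∘tabulate; toList-injective; toList-∷ʳ; length-toList; lookup-replicate; []=⇒lookup; lookup⇒[]=; cast-is-id)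
open import Data.Vec.Recursive using (Fin[m^n]↔Fin[m]^n; lift↔)
open import Data.Vec.Recursive.Properties using (↔Vec)
open import Data.Vec.Relation.Binary.Pointwise.Extensional using (ext; Pointwise-≡⇒≡)
open import Function using (_∘_; const)
open import Function.Bundles using (_⇔_; _↔_; mk⇔; Equivalence; Inverse; Injection)
open import Function.Properties.Equivalence using () renaming (sym to ⇔-sym)
open import Function.Properties.Inverse using (↔-trans; ↔⇒↣)
open import Relation.Nullary using (Dec; yes; no; does)
open import Relation.Binary.PropositionalEquality using (_≡_; _≢_; refl; sym; trans; cong; subst; module ≡-Reasoning)

open Equivalence using (to; from)

T-injective : ∀ {x y} → (T x → T y) → (T y → T x) → x ≡ y
T-injective {false} {false} _   _   = refl
T-injective {false} {true}  _   y⇒x = ⊥-elim (y⇒x _)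
T-injective {true}  {false} x⇒y _   = ⊥-elim (x⇒y _)
T-injective {true}  {true}  _   _   = refl

does≡true⇔ : ∀ {P : Set} (P? : Dec P) → does P? ≡ true ⇔ P
does≡true⇔ (yes p)  = mk⇔ (const p) (const refl)
does≡true⇔ (no ¬p) = mk⇔ (λ ()) (⊥-elim ∘ ¬p)

any-allFin-unique : ∀ {n} (f : Fin n → Bool) (q₀ : Fin n) →
                    (∀ q → q ≢ q₀ → f q ≡ false) → any f (allFin n) ≡ f q₀
any-allFin-unique {n} f q₀ others =
  T-injective (only-q₀ ∘ satisfied ∘ any⁻ f (allFin n)) (any⁺ f ∘ lose (∈-allFin q₀))
  where
  only-q₀ : ∃ (T ∘ f) → T (f q₀)
  only-q₀ (q , fq) with q ≟ q₀
  ... | yes refl  = fq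
  ... | no q≢q₀ = ⊥-elim (subst T (others q q≢q₀) fq)

lookup-⁅x⁆-self : ∀ {n} (x : Fin n) → lookup ⁅ x ⁆ x ≡ inside
lookup-⁅x⁆-self x = []=⇒lookup (x∈⁅x⁆ x)

lookup-⁅y⁆-other : ∀ {n} {x y : Fin n} → x ≢ y → lookup ⁅ y ⁆ x ≡ outside
lookup-⁅y⁆-other {x = x} {y} x≢y with lookup ⁅ y ⁆ x in x∈?⁅y⁆
... | true  = ⊥-elim (x≢y (x∈⁅y⁆⇒x≡y y (lookup⇒[]= x ⁅ y ⁆ x∈?⁅y⁆)))
... | false = refl

Fin[2^n]↔Subset : ∀ n → Fin (2 ^ n) ↔ Subset n
Fin[2^n]↔Subset n = ↔-trans (Fin[m^n]↔Fin[m]^n 2 n) (↔-trans (lift↔ n 2↔Bool) (↔Vec n))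

runSet-++ : ∀ {n} (M : GNFA n) S u v → runSet M S (u ++ v) ≡ runSet M (runSet M S u) v
runSet-++ M S []      v = refl
runSet-++ M S (a ∷ u) v = runSet-++ M (stepSet M S a) u v

run-++ : ∀ {k} (D : DFA k) q u v → run D q (u ++ v) ≡ run D (run D q u) v
run-++ D q []      v = refl
run-++ D q (a ∷ u) v = run-++ D (DFA.trans D q a) u v

lookup-stepSet : ∀ {n} (M : GNFA n) S a p (q₀ : Fin n) →
                 (∀ q → q ≢ q₀ → lookup (δ M q a) p ≡ false) →
                 lookup (stepSet M S a) p ≡ lookup S q₀ ∧ lookup (δ M q₀ a) p
lookup-stepSet M S a p q₀ others =
  trans (lookup∘tabulate _ p)
        (any-allFin-unique _ q₀ λ q q≢q₀ → trans (cong (lookup S q ∧_) (others q q≢q₀)) (∧-zeroʳ _))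

module SubsetConstruction {n} (M : GNFA n) where

  open Inverse (Fin[2^n]↔Subset n) renaming (to to decode; from to encode)

  subsetDFA : DFA (2 ^ n)
  subsetDFA = record
    { trans = λ q a → encode (stepSet M (decode q) a)
    ; start = encode (I M)
    ; final = λ q → does (nonempty? (decode q ∩ F M))
    }

  run-subsetDFA : ∀ S w → run subsetDFA (encode S) w ≡ encode (runSet M S w)
  run-subsetDFA S []      = refl
  run-subsetDFA S (a ∷ w) rewrite strictlyInverseˡ S = run-subsetDFA (stepSet M S a) w

  subsetDFA-accepts : AcceptsLang subsetDFA (L M)
  subsetDFA-accepts w
    rewrite run-subsetDFA (I M) w | strictlyInverseˡ (runSet M (I M) w) =
    does≡true⇔ (nonempty? (runSet M (I M) w ∩ F M))

open SubsetConstruction using (subsetDFA; subsetDFA-accepts)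

NerodeEquivalent : Language → Word → Word → Set
NerodeEquivalent L′ u v = ∀ x → L′ (u ++ x) ⇔ L′ (v ++ x)

sameState⇒nerodeEquivalent : ∀ {k} (D : DFA k) {L′} → AcceptsLang D L′ → ∀ u v →
  run D (DFA.start D) u ≡ run D (DFA.start D) v → NerodeEquivalent L′ u v
sameState⇒nerodeEquivalent D {L′} accepts u v same x =
  mk⇔ (transport u v same) (transport v u (sym same))
  where
  transport : ∀ u v → run D (DFA.start D) u ≡ run D (DFA.start D) v → L′ (u ++ x) → L′ (v ++ x)
  transport u v same ux = to (accepts (v ++ x)) (begin
    DFA.final D (run D (DFA.start D) (v ++ x))          ≡⟨ cong (DFA.final D) (run-++ D _ v x) ⟩
    DFA.final D (run D (run D (DFA.start D) v) x)       ≡⟨ cong (λ q → DFA.final D (run D q x)) (sym same) ⟩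
    DFA.final D (run D (run D (DFA.start D) u) x)       ≡⟨ cong (DFA.final D) (sym (run-++ D _ u x)) ⟩
    DFA.final D (run D (DFA.start D) (u ++ x))          ≡⟨ from (accepts (u ++ x)) ux ⟩
    true                                                ∎)
    where open ≡-Reasoning

nerodeSeparated⇒≤ : ∀ {m} (L′ : Language) (w : Fin m → Word) →
  (∀ {i j} → NerodeEquivalent L′ (w i) (w j) → i ≡ j) →
  ∀ k (D : DFA k) → AcceptsLang D L′ → m ≤ k
nerodeSeparated⇒≤ L′ w separated k D accepts =
  injective⇒≤ (separated ∘ sameState⇒nerodeEquivalent D accepts (w _) (w _))

shiftDown : ∀ {m} → Fin (suc m) → Fin (suc m)
shiftDown {m} zero = fromℕ m
shiftDown (suc i)  = inject₁ i

shiftDown-injective : ∀ {m} {q q′ : Fin (suc m)} → shiftDown q ≡ shiftDown q′ → q ≡ q′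
shiftDown-injective {q = zero}  {zero}   _  = refl
shiftDown-injective {q = zero}  {suc _}  eq = ⊥-elim (fromℕ≢inject₁ eq)
shiftDown-injective {q = suc _} {zero}   eq = ⊥-elim (fromℕ≢inject₁ (sym eq))
shiftDown-injective {q = suc _} {suc _}  eq = cong suc (inject₁-injective eq)

shiftDown-surjective : ∀ {m} (p : Fin (suc m)) → ∃ λ q → shiftDown q ≡ p
shiftDown-surjective {zero}  zero = zero , refl
shiftDown-surjective {suc m} zero = suc zero , refl
shiftDown-surjective {suc m} (suc p) with shiftDown-surjective p
... | zero  , eq = zero , cong suc eq
... | suc q , eq = suc (suc q) , cong suc eq

rotate : ∀ {m} → Subset (suc m) → Subset (suc m)
rotate (x Vec.∷ xs) = xs ∷ʳ x

remove₀ : ∀ {m} → Subset (suc m) → Subset (suc m)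
remove₀ (_ Vec.∷ xs) = outside Vec.∷ xs

lookup-∷ʳ-last : ∀ {m} {A : Set} (xs : Vec A m) x → lookup (xs ∷ʳ x) (fromℕ m) ≡ x
lookup-∷ʳ-last Vec.[]       x = refl
lookup-∷ʳ-last (_ Vec.∷ xs) x = lookup-∷ʳ-last xs x

lookup-∷ʳ-inject₁ : ∀ {m} {A : Set} (xs : Vec A m) x i → lookup (xs ∷ʳ x) (inject₁ i) ≡ lookup xs i
lookup-∷ʳ-inject₁ (_ Vec.∷ xs) x zero    = refl
lookup-∷ʳ-inject₁ (_ Vec.∷ xs) x (suc i) = lookup-∷ʳ-inject₁ xs x i

lookup-rotate : ∀ {m} (S : Subset (suc m)) q → lookup (rotate S) (shiftDown q) ≡ lookup S q
lookup-rotate (x Vec.∷ xs) zero    = lookup-∷ʳ-last xs x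
lookup-rotate (x Vec.∷ xs) (suc i) = lookup-∷ʳ-inject₁ xs x i

pattern kill = zero
pattern rot  = suc zero

cycleδ : ∀ {m} → Fin (suc m) → Σ₂ → Subset (suc m)
cycleδ q       rot  = ⁅ shiftDown q ⁆
cycleδ zero    kill = ⊥
cycleδ (suc q) kill = ⁅ suc q ⁆

cycleNFA : ∀ m → GNFA (suc m)
cycleNFA m = record { δ = cycleδ ; I = ⊤ ; F = ⊤ }

stepSet-rot : ∀ {m} (S : Subset (suc m)) → stepSet (cycleNFA m) S rot ≡ rotate S
stepSet-rot {m} S = Pointwise-≡⇒≡ (ext λ p → at (shiftDown-surjective p))
  where
  at : ∀ {p} → ∃ (λ q → shiftDown q ≡ p) → lookup (stepSet (cycleNFA m) S rot) p ≡ lookup (rotate S) p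
  at (q₀ , refl) = begin
    lookup (stepSet (cycleNFA m) S rot) (shiftDown q₀)
      ≡⟨ lookup-stepSet (cycleNFA m) S rot _ q₀ (λ q q≢q₀ → lookup-⁅y⁆-other (q≢q₀ ∘ shiftDown-injective ∘ sym)) ⟩
    lookup S q₀ ∧ lookup ⁅ shiftDown q₀ ⁆ (shiftDown q₀)
      ≡⟨ cong (lookup S q₀ ∧_) (lookup-⁅x⁆-self (shiftDown q₀)) ⟩
    lookup S q₀ ∧ true
      ≡⟨ ∧-identityʳ _ ⟩
    lookup S q₀
      ≡⟨ sym (lookup-rotate S q₀) ⟩
    lookup (rotate S) (shiftDown q₀) ∎
    where open ≡-Reasoning

stepSet-kill : ∀ {m} (S : Subset (suc m)) → stepSet (cycleNFA m) S kill ≡ remove₀ S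
stepSet-kill {m} S@(x Vec.∷ _) = Pointwise-≡⇒≡ (ext at)
  where
  at : ∀ p → lookup (stepSet (cycleNFA m) S kill) p ≡ lookup (remove₀ S) p
  at zero = trans (lookup-stepSet (cycleNFA m) S kill zero zero others) (∧-zeroʳ x)
    where
    others : ∀ q → q ≢ zero → lookup (cycleδ q kill) zero ≡ false
    others zero    q≢0 = ⊥-elim (q≢0 refl)
    others (suc q) _   = refl
  at (suc j) = trans (lookup-stepSet (cycleNFA m) S kill (suc j) (suc j) others)
                     (trans (cong (lookup S (suc j) ∧_) (lookup-⁅x⁆-self (suc j))) (∧-identityʳ _))
    where
    others : ∀ q → q ≢ suc j → lookup (cycleδ q kill) (suc j) ≡ false
    others zero    _      = lookup-replicate j false
    others (suc q) q≢1+j = lookup-⁅y⁆-other (q≢1+j ∘ sym)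

-- Lists rather than vectors, so that runᴸ-maskBits may split the state as xs ++ ys freely.
actᴸ : Σ₂ → List Bool → List Bool
actᴸ _    []       = []
actᴸ kill (_ ∷ xs) = false ∷ xs
actᴸ rot  (x ∷ xs) = xs ++ [ x ]

runᴸ : Word → List Bool → List Bool
runᴸ []      xs = xs
runᴸ (a ∷ w) xs = runᴸ w (actᴸ a xs)

toList-stepSet : ∀ {m} (S : Subset (suc m)) a → toList (stepSet (cycleNFA m) S a) ≡ actᴸ a (toList S)
toList-stepSet S@(_ Vec.∷ _) kill = cong toList (stepSet-kill S)
toList-stepSet S@(x Vec.∷ xs) rot  = trans (cong toList (stepSet-rot S)) (toList-∷ʳ x xs)

toList-runSet : ∀ {m} (S : Subset (suc m)) w → toList (runSet (cycleNFA m) S w) ≡ runᴸ w (toList S)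
toList-runSet S []      = refl
toList-runSet S (a ∷ w) rewrite toList-runSet (stepSet (cycleNFA _) S a) w = cong (runᴸ w) (toList-stepSet S a)

toList-zipWith : ∀ {n} {A B C : Set} (f : A → B → C) (xs : Vec A n) ys →
                 toList (Vec.zipWith f xs ys) ≡ zipWith f (toList xs) (toList ys)
toList-zipWith f Vec.[]       Vec.[]       = refl
toList-zipWith f (x Vec.∷ xs) (y Vec.∷ ys) = cong (f x y ∷_) (toList-zipWith f xs ys)

maskBits : List Bool → Word
maskBits []          = []
maskBits (true  ∷ t) = rot ∷ maskBits t
maskBits (false ∷ t) = kill ∷ rot ∷ maskBits t

runᴸ-maskBits-∷ : ∀ b t x xs → runᴸ (maskBits (b ∷ t)) (x ∷ xs) ≡ runᴸ (maskBits t) (xs ++ [ x ∧ b ])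
runᴸ-maskBits-∷ true  t x xs rewrite ∧-identityʳ x = refl
runᴸ-maskBits-∷ false t x xs rewrite ∧-zeroʳ x     = refl

runᴸ-maskBits : ∀ xs ys t → length xs ≡ length t → runᴸ (maskBits t) (xs ++ ys) ≡ ys ++ zipWith _∧_ xs t
runᴸ-maskBits []       ys []      _  = sym (++-identityʳ ys)
runᴸ-maskBits (x ∷ xs) ys (b ∷ t) eq = begin
  runᴸ (maskBits (b ∷ t)) (x ∷ xs ++ ys)      ≡⟨ runᴸ-maskBits-∷ b t x (xs ++ ys) ⟩
  runᴸ (maskBits t) ((xs ++ ys) ++ [ x ∧ b ])  ≡⟨ cong (runᴸ (maskBits t)) (++-assoc xs ys _) ⟩
  runᴸ (maskBits t) (xs ++ ys ++ [ x ∧ b ])    ≡⟨ runᴸ-maskBits xs _ t (cong pred eq) ⟩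
  (ys ++ [ x ∧ b ]) ++ zipWith _∧_ xs t        ≡⟨ ++-assoc ys _ _ ⟩
  ys ++ zipWith _∧_ (x ∷ xs) (b ∷ t)           ∎
  where open ≡-Reasoning

maskWord : ∀ {n} → Subset n → Word
maskWord T = maskBits (toList T)

runSet-maskWord : ∀ {m} (X T : Subset (suc m)) → runSet (cycleNFA m) X (maskWord T) ≡ X ∩ T
runSet-maskWord X T = trans (sym (cast-is-id refl _)) (toList-injective refl _ _ (begin
  toList (runSet (cycleNFA _) X (maskWord T))   ≡⟨ toList-runSet X (maskWord T) ⟩
  runᴸ (maskWord T) (toList X)                  ≡⟨ cong (runᴸ (maskWord T)) (sym (++-identityʳ (toList X))) ⟩
  runᴸ (maskWord T) (toList X ++ [])            ≡⟨ runᴸ-maskBits (toList X) [] (toList T) (trans (length-toList X) (sym (length-toList T))) ⟩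
  zipWith _∧_ (toList X) (toList T)             ≡⟨ sym (toList-zipWith _∧_ X T) ⟩
  toList (X ∩ T)                                ∎))
  where open ≡-Reasoning

accepts-maskWord-⁅p⁆ : ∀ {m} (S : Subset (suc m)) p → L (cycleNFA m) (maskWord S ++ maskWord ⁅ p ⁆) ⇔ p ∈ S
accepts-maskWord-⁅p⁆ {m} S p
  rewrite runSet-++ (cycleNFA m) ⊤ (maskWord S) (maskWord ⁅ p ⁆)
        | runSet-maskWord ⊤ S | ∩-identityˡ S | runSet-maskWord S ⁅ p ⁆ =
  mk⇔ (λ (x , x∈S∩⁅p⁆∩⊤) → let x∈S , x∈⁅p⁆ = x∈p∩q⁻ S ⁅ p ⁆ (proj₁ (x∈p∩q⁻ _ ⊤ x∈S∩⁅p⁆∩⊤))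
                          in subst (_∈ S) (x∈⁅y⁆⇒x≡y p x∈⁅p⁆) x∈S)
      (λ p∈S → p , x∈p∩q⁺ (x∈p∩q⁺ (p∈S , x∈⁅x⁆ p) , ∈⊤))

nerodeEquivalent⇒⊆ : ∀ {m} {S T : Subset (suc m)} →
  NerodeEquivalent (L (cycleNFA m)) (maskWord S) (maskWord T) → S ⊆ T
nerodeEquivalent⇒⊆ {S = S} {T} equiv {p} p∈S =
  to (accepts-maskWord-⁅p⁆ T p) (to (equiv (maskWord ⁅ p ⁆)) (from (accepts-maskWord-⁅p⁆ S p) p∈S))

nerodeEquivalent⇒≡ : ∀ {m} {S T : Subset (suc m)} →
  NerodeEquivalent (L (cycleNFA m)) (maskWord S) (maskWord T) → S ≡ T
nerodeEquivalent⇒≡ equiv = ⊆-antisym (nerodeEquivalent⇒⊆ equiv) (nerodeEquivalent⇒⊆ (⇔-sym ∘ equiv))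

cycleNFA-lowerBound : ∀ m k (D : DFA k) → AcceptsLang D (L (cycleNFA m)) → 2 ^ suc m ≤ k
cycleNFA-lowerBound m = nerodeSeparated⇒≤ _ (maskWord ∘ decode) (injective ∘ nerodeEquivalent⇒≡)
  where open Injection (↔⇒↣ (Fin[2^n]↔Subset (suc m))) renaming (to to decode)

theorem8 : (n : ℕ) → 1 ≤ n →
    Σ (GNFA n) (λ M → (I M ≡ ⊤) × (F M ≡ ⊤) × MinimalDFASize (L M) (2 ^ n))
theorem8 (suc m) _ =
  cycleNFA m , refl , refl ,
  (subsetDFA (cycleNFA m) , subsetDFA-accepts (cycleNFA m)) , cycleNFA-lowerBound m
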